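{- Let $G$ be a graph such that $\gamma_t(G) \geq 3$. Then for any minimum total dominating set $D$ of $G$, if there exist three distinct vertices $x,y,z \in D$ such that $xy \in E(G)$ and $d(z,\{x,y\}) \leq 2$, then $ct_{\gamma_t}(G) \leq 2$.
   Context: All graphs are finite and simple (and connected). A total dominating set of $G$ is a set $D\subseteq V(G)$ such that every vertex of $G$ has a neighbour in $D$; $\gamma_t(G)$ is the minimum size of such a set. $d(z,S)=\min_{s\in S} d(z,s)$ where $d$ is the shortest-path distance. The contraction of an edge $xy$ removes $x,y$ and adds a new vertex adjacent to all former neighbours of $x$ or $y$ (no loops/multi-edges). $ct_{\gamma_t}(G)$ is the minimum number of edge contractions needed to transform $G$ into a graph $H$ with $\gamma_t(H)=\gamma_t(G)-1$. -}

module Defs where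

open import Data.Nat using (ℕ; zero; suc; _≤_; _∸_)
open import Data.Bool using (Bool; true; false)
open import Data.Fin using (Fin)
open import Data.Fin.Subset using (Subset; _∈_; ∣_∣)
open import Data.Product using (Σ; ∃; ∃-syntax; _×_; _,_)
open import Data.Sum using (_⊎_)
open import Relation.Binary.PropositionalEquality using (_≡_; _≢_)
open import Relation.Nullary using (¬_)
open import Function.Bundles using (_⇔_)

record Graph : Set where
  field
    n      : ℕ
    adj    : Fin n → Fin n → Bool
    sym    : ∀ u v → adj u v ≡ adj v u
    irrefl : ∀ v → adj v v ≡ false

open Graph public

Adj : (G : Graph) → Fin (n G) → Fin (n G) → Set
Adj G u v = adj G u v ≡ true

Dist≤ : (G : Graph) → ℕ → Fin (n G) → Fin (n G) → Set
Dist≤ G zero    u v = u ≡ v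
Dist≤ G (suc k) u v = u ≡ v ⊎ (∃[ w ] (Adj G u w × Dist≤ G k w v))

Connected : Graph → Set
Connected G = ∀ u v → ∃[ k ] Dist≤ G k u v

IsTDS : (G : Graph) → Subset (n G) → Set
IsTDS G D = ∀ v → ∃[ u ] (u ∈ D × Adj G v u)

IsMinTDS : (G : Graph) → Subset (n G) → Set
IsMinTDS G D = IsTDS G D × (∀ D' → IsTDS G D' → ∣ D ∣ ≤ ∣ D' ∣)

GammaT≡ : Graph → ℕ → Set
GammaT≡ G k = Σ (Subset (n G)) λ D → IsMinTDS G D × ∣ D ∣ ≡ k

-- H is (isomorphic to) the graph obtained from G by contracting the edge xy:
-- f : V(G) → V(H) is surjective, identifies exactly x and y, and
-- a,b adjacent in H iff a ≠ b and they have adjacent preimages in G.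
ContractEdge : Graph → Graph → Set
ContractEdge G H =
  Σ (Fin (n G)) λ x → Σ (Fin (n G)) λ y → Σ (Fin (n G) → Fin (n H)) λ f →
    Adj G x y
  × f x ≡ f y
  × (∀ u v → f u ≡ f v → u ≡ v ⊎ ((u ≡ x ⊎ u ≡ y) × (v ≡ x ⊎ v ≡ y)))
  × (∀ a → ∃[ u ] f u ≡ a)
  × (∀ a b → (Adj H a b ⇔ (a ≢ b × ∃[ u ] ∃[ v ] (f u ≡ a × f v ≡ b × Adj G u v))))

data Contracts : Graph → ℕ → Graph → Set where
  done : ∀ {G} → Contracts G zero G
  step : ∀ {G G' H k} → ContractEdge G G' → Contracts G' k H → Contracts G (suc k) H

CtGammaT≤ : Graph → ℕ → Set
CtGammaT≤ G m = ∃[ k ] (k ≤ m × Σ Graph λ H → Contracts G k H ×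
                  (∀ g → GammaT≡ G g → GammaT≡ H (g ∸ 1)))

-- Contracting an edge xy lowers γt by at most one: a total dominating set T of
-- the contracted graph lifts to one of size at most |T| + 1 (the preimage of T,
-- plus one endpoint of xy when the merged vertex is not in T).  It lowers γt by
-- exactly one as soon as x, y ∈ D and some third t ∈ D is adjacent to x or y:
-- the image of D is then total dominating, t dominating the merged vertex.
-- This applies directly if z is adjacent to x, or reaches x through a vertex
-- w ∈ D.  Otherwise z – w – x with w ∉ D; contracting zw either lowers γt at
-- once, or keeps γt = |D|, and then the images of x, z and y are in the first
-- situation in the contracted graph.
module Submission where

open import Defs hiding (sym)
open import Data.Nat using (ℕ; zero; suc; _≤_; _<_; _∸_; s≤s; _<?_)
open import Data.Nat.Properties using (≤-refl; ≤-reflexive; ≤-trans; ≤-antisym; n≤1+n; ≮⇒≥; ∸-monoˡ-≤)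
open import Data.Bool using (Bool; true; false)
import Data.Bool.Properties as Bool
open import Data.Fin using (Fin; zero; suc; punchIn; punchOut; _≟_)
open import Data.Fin.Properties using (punchInᵢ≢i; punchIn-punchOut; punchOut-punchIn; any?; all?)
open import Data.Fin.Subset using (Subset; _∈_; _∉_; ∣_∣; _∪_; ⁅_⁆)
open import Data.Fin.Subset.Properties using (_∈?_; anySubset?; x∈⁅x⁆; x∈p∪q⁺; ∪-identityʳ)
open import Data.Vec using (_∷_; lookup; insertAt; removeAt)
open import Data.Vec.Properties using (insertAt-lookup; insertAt-punchIn; insertAt-removeAt; removeAt-punchOut; []=⇒lookup; lookup⇒[]=)
open import Data.Product using (∃-syntax; _×_; _,_; proj₁; proj₂)
open import Data.Sum using (_⊎_; inj₁; inj₂)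
open import Function using (_∘_; const)
open import Function.Bundles using (_⇔_; mk⇔; Equivalence)
open import Relation.Nullary using (Dec; yes; no; does; contradiction)
open import Relation.Nullary.Decidable using (_×-dec_; ¬?; dec-false; does-⇔)
open import Relation.Binary.PropositionalEquality using (_≡_; _≢_; refl; sym; trans; cong; subst)

private
  variable
    k : ℕ

∣insertAt∣ : ∀ (T : Subset k) i b → ∣ insertAt T i b ∣ ≡ ∣ b ∷ T ∣
∣insertAt∣ T           zero    b     = refl
∣insertAt∣ (true ∷ T)  (suc i) true  = cong suc (∣insertAt∣ T i true)
∣insertAt∣ (true ∷ T)  (suc i) false = cong suc (∣insertAt∣ T i false)
∣insertAt∣ (false ∷ T) (suc i) true  = ∣insertAt∣ T i true
∣insertAt∣ (false ∷ T) (suc i) false = ∣insertAt∣ T i false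

<⇒≤∸1 : ∀ {a b} → a < b → a ≤ b ∸ 1
<⇒≤∸1 (s≤s a≤b) = a≤b

∣b∷p∣≤1+∣p∣ : ∀ b (p : Subset k) → ∣ b ∷ p ∣ ≤ suc ∣ p ∣
∣b∷p∣≤1+∣p∣ true  p = ≤-refl
∣b∷p∣≤1+∣p∣ false p = n≤1+n ∣ p ∣

∣p∪⁅x⁆∣≤1+∣p∣ : ∀ (p : Subset k) x → ∣ p ∪ ⁅ x ⁆ ∣ ≤ suc ∣ p ∣
∣p∪⁅x⁆∣≤1+∣p∣ (true ∷ p)  zero    rewrite ∪-identityʳ p = n≤1+n _
∣p∪⁅x⁆∣≤1+∣p∣ (false ∷ p) zero    rewrite ∪-identityʳ p = ≤-refl
∣p∪⁅x⁆∣≤1+∣p∣ (true ∷ p)  (suc x) = s≤s (∣p∪⁅x⁆∣≤1+∣p∣ p x)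
∣p∪⁅x⁆∣≤1+∣p∣ (false ∷ p) (suc x) = ∣p∪⁅x⁆∣≤1+∣p∣ p x

∣removeAt∣ : ∀ (S : Subset (suc k)) i → ∣ S ∣ ≡ ∣ lookup S i ∷ removeAt S i ∣
∣removeAt∣ S i = trans (cong ∣_∣ (sym (insertAt-removeAt S i))) (∣insertAt∣ (removeAt S i) i _)

∉⇒lookup≡false : ∀ {S : Subset k} {i} → i ∉ S → lookup S i ≡ false
∉⇒lookup≡false {S = S} {i} i∉S with lookup S i in eq
... | true  = contradiction (lookup⇒[]= i S eq) i∉S
... | false = refl

does≡true⇔ : ∀ {P : Set} (P? : Dec P) → does P? ≡ true ⇔ P
does≡true⇔ (yes p) = mk⇔ (const p) (const refl)
does≡true⇔ (no ¬p) = mk⇔ (λ ()) (λ p → contradiction p ¬p)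

Adj-sym : ∀ G {u v} → Adj G u v → Adj G v u
Adj-sym G {u} {v} u~v = trans (Graph.sym G v u) u~v

Adj⇒≢ : ∀ G {u v} → Adj G u v → u ≢ v
Adj⇒≢ G {u} u~u refl with trans (sym u~u) (irrefl G u)
... | ()

IsTDS? : ∀ G (S : Subset (n G)) → Dec (IsTDS G S)
IsTDS? G S = all? λ v → any? λ u → (u ∈? S) ×-dec (adj G v u Bool.≟ true)

GammaT≡-transfer : ∀ {G H D S} m → IsMinTDS G D → IsMinTDS H S → ∣ S ∣ ≡ ∣ D ∣ ∸ m →
                   ∀ g → GammaT≡ G g → GammaT≡ H (g ∸ m)
GammaT≡-transfer m (D-tds , D-min) S-min ∣S∣≡ g (D' , (D'-tds , D'-min) , refl) =
  _ , S-min , trans ∣S∣≡ (cong (_∸ m) (≤-antisym (D-min D' D'-tds) (D'-min _ D-tds)))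

CtGammaT≤-mono : ∀ {G m m'} → m ≤ m' → CtGammaT≤ G m → CtGammaT≤ G m'
CtGammaT≤-mono m≤m' (j , j≤m , rest) = j , ≤-trans j≤m m≤m' , rest

CtGammaT≤-step : ∀ {G H m} → ContractEdge G H → (∀ g → GammaT≡ G g → GammaT≡ H g) →
                 CtGammaT≤ H m → CtGammaT≤ G (suc m)
CtGammaT≤-step G↠H γ-kept (j , j≤m , K , H↠K , γ-drops) =
  suc j , s≤s j≤m , K , step G↠H H↠K , λ g → γ-drops g ∘ γ-kept g

-- image S agrees with f[S] only when y ∈ S → x ∈ S.
record Contraction (G : Graph) (x y : Fin (n G)) : Set where
  field
    H               : Graph
    f               : Fin (n G) → Fin (n H)
    f-merges        : f x ≡ f y
    f-injective-off : ∀ u v → f u ≡ f v → u ≡ v ⊎ ((u ≡ x ⊎ u ≡ y) × (v ≡ x ⊎ v ≡ y))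
    f-surjective    : ∀ a → ∃[ u ] f u ≡ a
    adj-H           : ∀ a b → Adj H a b ⇔ (a ≢ b × ∃[ u ] ∃[ v ] (f u ≡ a × f v ≡ b × Adj G u v))
    image           : Subset (n G) → Subset (n H)
    ∈-image         : ∀ {S u} → (y ∈ S → x ∈ S) → u ∈ S → f u ∈ image S
    ∣image∣-∉       : ∀ {S} → y ∉ S → ∣ image S ∣ ≡ ∣ S ∣
    ∣image∣-∈       : ∀ {S} → y ∈ S → ∣ S ∣ ≡ suc ∣ image S ∣
    preimage        : Subset (n H) → Subset (n G)
    ∈-preimage      : ∀ {T u} → f u ∈ T → u ∈ preimage T
    ∣preimage∣-≤    : ∀ T → ∣ preimage T ∣ ≤ suc ∣ T ∣
    ∣preimage∣-∉    : ∀ {T} → f x ∉ T → ∣ preimage T ∣ ≡ ∣ T ∣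

-- The contracted graph lives on Fin m: y is deleted (punchOut y) and sent to x.
module Construction {m} (A : Fin (suc m) → Fin (suc m) → Bool)
                    (A-sym : ∀ u v → A u v ≡ A v u) (A-irrefl : ∀ v → A v v ≡ false)
                    {x y : Fin (suc m)} (x≢y : x ≢ y) where

  G : Graph
  G = record { n = suc m ; adj = A ; sym = A-sym ; irrefl = A-irrefl }

  x' : Fin m
  x' = punchOut (x≢y ∘ sym)

  f : Fin (suc m) → Fin m
  f v with y ≟ v
  ... | yes _   = x'
  ... | no y≢v  = punchOut y≢v

  f-punchIn : ∀ a → f (punchIn y a) ≡ a
  f-punchIn a with y ≟ punchIn y a
  ... | yes y≡ = contradiction (sym y≡) (punchInᵢ≢i y a)
  ... | no _   = punchOut-punchIn y

  punchIn-f : ∀ {u} → u ≢ y → punchIn y (f u) ≡ u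
  punchIn-f {u} u≢y with y ≟ u
  ... | yes y≡u = contradiction (sym y≡u) u≢y
  ... | no y≢u  = punchIn-punchOut y≢u

  f-y : f y ≡ x'
  f-y with y ≟ y
  ... | yes _  = refl
  ... | no y≢y = contradiction refl y≢y

  punchIn-x' : punchIn y x' ≡ x
  punchIn-x' = punchIn-punchOut (x≢y ∘ sym)

  f-x : f x ≡ x'
  f-x = trans (cong f (sym punchIn-x')) (f-punchIn x')

  f≡x'⇒≡x : ∀ {u} → u ≢ y → f u ≡ x' → u ≡ x
  f≡x'⇒≡x u≢y fu≡x' = trans (sym (punchIn-f u≢y)) (trans (cong (punchIn y) fu≡x') punchIn-x')

  f-injective-off : ∀ u v → f u ≡ f v → u ≡ v ⊎ ((u ≡ x ⊎ u ≡ y) × (v ≡ x ⊎ v ≡ y))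
  f-injective-off u v fu≡fv with u ≟ y | v ≟ y
  ... | yes refl | yes refl = inj₁ refl
  ... | yes refl | no v≢y   = inj₂ (inj₂ refl , inj₁ (f≡x'⇒≡x v≢y (trans (sym fu≡fv) f-y)))
  ... | no u≢y   | yes refl = inj₂ (inj₁ (f≡x'⇒≡x u≢y (trans fu≡fv f-y)) , inj₂ refl)
  ... | no u≢y   | no v≢y   =
    inj₁ (trans (sym (punchIn-f u≢y)) (trans (cong (punchIn y) fu≡fv) (punchIn-f v≢y)))

  Merged : Fin m → Fin m → Set
  Merged a b = a ≢ b × ∃[ u ] ∃[ v ] (f u ≡ a × f v ≡ b × Adj G u v)

  Merged? : ∀ a b → Dec (Merged a b)
  Merged? a b = ¬? (a ≟ b) ×-dec
    any? λ u → any? λ v → (f u ≟ a) ×-dec ((f v ≟ b) ×-dec (A u v Bool.≟ true))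

  Merged-sym : ∀ {a b} → Merged a b → Merged b a
  Merged-sym (a≢b , u , v , fu≡a , fv≡b , u~v) = a≢b ∘ sym , v , u , fv≡b , fu≡a , Adj-sym G u~v

  H : Graph
  H = record
    { n      = m
    ; adj    = λ a b → does (Merged? a b)
    ; sym    = λ a b → does-⇔ (mk⇔ Merged-sym Merged-sym) (Merged? a b) (Merged? b a)
    ; irrefl = λ a → dec-false (Merged? a a) (λ (a≢a , _) → a≢a refl)
    }

  adj-H : ∀ a b → Adj H a b ⇔ Merged a b
  adj-H a b = does≡true⇔ (Merged? a b)

  lookup-removeAt : ∀ (S : Subset (suc m)) a → lookup (removeAt S y) a ≡ lookup S (punchIn y a)
  lookup-removeAt S a =
    trans (cong (lookup (removeAt S y)) (sym (punchOut-punchIn y))) (removeAt-punchOut S (punchInᵢ≢i y a ∘ sym))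

  ∈-removeAt : ∀ {S a} → punchIn y a ∈ S → a ∈ removeAt S y
  ∈-removeAt {S} {a} p = lookup⇒[]= a _ (trans (lookup-removeAt S a) ([]=⇒lookup p))

  ∈-image : ∀ {S u} → (y ∈ S → x ∈ S) → u ∈ S → f u ∈ removeAt S y
  ∈-image {S} {u} closed u∈S with u ≟ y
  ... | yes refl = ∈-removeAt (subst (_∈ S) (sym (trans (cong (punchIn y) f-y) punchIn-x')) (closed u∈S))
  ... | no u≢y   = ∈-removeAt (subst (_∈ S) (sym (punchIn-f u≢y)) u∈S)

  ∣image∣-∉ : ∀ {S} → y ∉ S → ∣ removeAt S y ∣ ≡ ∣ S ∣
  ∣image∣-∉ {S} y∉S =
    sym (trans (∣removeAt∣ S y) (cong (λ b → ∣ b ∷ removeAt S y ∣) (∉⇒lookup≡false y∉S)))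

  ∣image∣-∈ : ∀ {S} → y ∈ S → ∣ S ∣ ≡ suc ∣ removeAt S y ∣
  ∣image∣-∈ {S} y∈S = trans (∣removeAt∣ S y) (cong (λ b → ∣ b ∷ removeAt S y ∣) ([]=⇒lookup y∈S))

  preimage : Subset m → Subset (suc m)
  preimage T = insertAt T y (lookup T x')

  lookup-preimage : ∀ T u → lookup (preimage T) u ≡ lookup T (f u)
  lookup-preimage T u with u ≟ y
  ... | yes refl = trans (insertAt-lookup T y _) (cong (lookup T) (sym f-y))
  ... | no u≢y   = trans (cong (lookup (preimage T)) (sym (punchIn-f u≢y))) (insertAt-punchIn T y _ (f u))

  ∈-preimage : ∀ {T u} → f u ∈ T → u ∈ preimage T
  ∈-preimage {T} {u} fu∈T = lookup⇒[]= u _ (trans (lookup-preimage T u) ([]=⇒lookup fu∈T))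

  ∣preimage∣-≤ : ∀ T → ∣ preimage T ∣ ≤ suc ∣ T ∣
  ∣preimage∣-≤ T = ≤-trans (≤-reflexive (∣insertAt∣ T y _)) (∣b∷p∣≤1+∣p∣ (lookup T x') T)

  ∣preimage∣-∉ : ∀ {T} → f x ∉ T → ∣ preimage T ∣ ≡ ∣ T ∣
  ∣preimage∣-∉ {T} fx∉T =
    trans (∣insertAt∣ T y _) (cong (λ b → ∣ b ∷ T ∣) (∉⇒lookup≡false (subst (_∉ T) f-x fx∉T)))

  contraction : Contraction G x y
  contraction = record
    { H = H ; f = f ; f-merges = trans f-x (sym f-y) ; f-injective-off = f-injective-off
    ; f-surjective = λ a → punchIn y a , f-punchIn a ; adj-H = adj-H
    ; image = λ S → removeAt S y ; ∈-image = ∈-image ; ∣image∣-∉ = ∣image∣-∉ ; ∣image∣-∈ = ∣image∣-∈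
    ; preimage = preimage ; ∈-preimage = ∈-preimage
    ; ∣preimage∣-≤ = ∣preimage∣-≤ ; ∣preimage∣-∉ = ∣preimage∣-∉
    }

contract : ∀ G {x y : Fin (n G)} → x ≢ y → Contraction G x y
contract record { n = zero } {()}
contract record { n = suc m ; adj = A ; sym = A-sym ; irrefl = A-irrefl } x≢y =
  Construction.contraction A A-sym A-irrefl x≢y

module Contracted {G : Graph} {x y : Fin (n G)} (c : Contraction G x y) (x~y : Adj G x y) where
  open Contraction c

  f-Adj : ∀ {u v} → Adj G u v → f u ≢ f v → Adj H (f u) (f v)
  f-Adj {u} {v} u~v fu≢fv = Equivalence.from (adj-H (f u) (f v)) (fu≢fv , u , v , refl , refl , u~v)

  f-≢ : ∀ {a b} → a ≢ b → a ≢ x → a ≢ y → f a ≢ f b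
  f-≢ {a} {b} a≢b a≢x a≢y fa≡fb with f-injective-off a b fa≡fb
  ... | inj₁ a≡b             = a≢b a≡b
  ... | inj₂ (inj₁ a≡x , _)  = a≢x a≡x
  ... | inj₂ (inj₂ a≡y , _)  = a≢y a≡y

  f-collision : ∀ {u v} → u ≢ v → f u ≡ f v → u ≡ x ⊎ u ≡ y
  f-collision {u} {v} u≢v fu≡fv with f-injective-off u v fu≡fv
  ... | inj₁ u≡v         = contradiction u≡v u≢v
  ... | inj₂ (u∈xy , _)  = u∈xy

  f-endpoint : ∀ {u} → u ≡ x ⊎ u ≡ y → f u ≡ f x
  f-endpoint (inj₁ refl) = refl
  f-endpoint (inj₂ refl) = sym f-merges

  endpoints-Adj : ∀ {u v} → u ≡ x ⊎ u ≡ y → v ≡ x ⊎ v ≡ y → u ≢ v → Adj G u v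
  endpoints-Adj (inj₁ refl) (inj₁ refl) u≢v = contradiction refl u≢v
  endpoints-Adj (inj₁ refl) (inj₂ refl) _   = x~y
  endpoints-Adj (inj₂ refl) (inj₁ refl) _   = Adj-sym G x~y
  endpoints-Adj (inj₂ refl) (inj₂ refl) u≢v = contradiction refl u≢v

  endpoint-neighbour-Adj : ∀ {u t} → u ≡ x ⊎ u ≡ y → Adj G u t → t ≢ x → t ≢ y → Adj H (f x) (f t)
  endpoint-neighbour-Adj {t = t} u∈xy u~t t≢x t≢y = subst (λ a → Adj H a (f t)) (f-endpoint u∈xy)
    (f-Adj u~t λ fu≡ft → f-≢ t≢x t≢x t≢y (trans (sym fu≡ft) (f-endpoint u∈xy)))

  merged-Adj : ∀ {t} → t ≢ x → t ≢ y → Adj G t x ⊎ Adj G t y → Adj H (f x) (f t)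
  merged-Adj t≢x t≢y (inj₁ t~x) = endpoint-neighbour-Adj (inj₁ refl) (Adj-sym G t~x) t≢x t≢y
  merged-Adj t≢x t≢y (inj₂ t~y) = endpoint-neighbour-Adj (inj₂ refl) (Adj-sym G t~y) t≢x t≢y

  image-isTDS : ∀ {S} → IsTDS G S → (y ∈ S → x ∈ S) →
                ∀ {t} → t ∈ S → t ≢ x → t ≢ y → Adj G t x ⊎ Adj G t y → IsTDS H (image S)
  image-isTDS {S} S-tds closed {t} t∈S t≢x t≢y t~xy a with f-surjective a
  ... | v , refl with S-tds v
  ... | u , u∈S , v~u with f v ≟ f u
  ... | no fv≢fu   = f u , ∈-image closed u∈S , f-Adj v~u fv≢fu
  ... | yes fv≡fu  = f t , ∈-image closed t∈S ,
    subst (λ b → Adj H b (f t)) (sym (f-endpoint (f-collision (Adj⇒≢ G v~u) fv≡fu))) (merged-Adj t≢x t≢y t~xy)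

  preimage-dominates : ∀ {T} → IsTDS H T → ∀ {v} → v ≢ x → v ≢ y → ∃[ u ] (u ∈ preimage T × Adj G v u)
  preimage-dominates {T} T-tds {v} v≢x v≢y with T-tds (f v)
  ... | a , a∈T , fv~a with Equivalence.to (adj-H (f v) a) fv~a
  ... | _ , v₁ , u , fv₁≡fv , fu≡a , v₁~u with f-injective-off v₁ v fv₁≡fv
  ... | inj₁ refl              = u , ∈-preimage (subst (_∈ T) (sym fu≡a) a∈T) , v₁~u
  ... | inj₂ (_ , inj₁ v≡x)    = contradiction v≡x v≢x
  ... | inj₂ (_ , inj₂ v≡y)    = contradiction v≡y v≢y

  endpoint? : ∀ v → (v ≡ x ⊎ v ≡ y) ⊎ (v ≢ x × v ≢ y)
  endpoint? v with v ≟ x | v ≟ y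
  ... | yes v≡x | _       = inj₁ (inj₁ v≡x)
  ... | no _    | yes v≡y = inj₁ (inj₂ v≡y)
  ... | no v≢x  | no v≢y  = inj₂ (v≢x , v≢y)

  preimage-isTDS : ∀ {T} → IsTDS H T → f x ∈ T → IsTDS G (preimage T)
  preimage-isTDS {T} T-tds fx∈T v with endpoint? v
  ... | inj₁ (inj₁ refl)     = y , ∈-preimage (subst (_∈ T) f-merges fx∈T) , x~y
  ... | inj₁ (inj₂ refl)     = x , ∈-preimage fx∈T , Adj-sym G x~y
  ... | inj₂ (v≢x , v≢y)     = preimage-dominates T-tds v≢x v≢y

  preimage∪endpoint-isTDS : ∀ {T u w} → IsTDS H T → u ≡ x ⊎ u ≡ y → w ∈ preimage T → Adj G u w →
                            IsTDS G (preimage T ∪ ⁅ u ⁆)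
  preimage∪endpoint-isTDS {T} {u} T-tds u∈xy w∈ u~w v with v ≟ u | endpoint? v
  ... | yes refl | _                 = _ , x∈p∪q⁺ (inj₁ w∈) , u~w
  ... | no v≢u   | inj₁ v∈xy         = u , x∈p∪q⁺ (inj₂ (x∈⁅x⁆ u)) , endpoints-Adj v∈xy u∈xy v≢u
  ... | no _     | inj₂ (v≢x , v≢y)  =
    let (w' , w'∈ , v~w') = preimage-dominates T-tds v≢x v≢y in w' , x∈p∪q⁺ (inj₁ w'∈) , v~w'

  lift-isTDS : ∀ {T} → IsTDS H T → ∃[ S ] (IsTDS G S × ∣ S ∣ ≤ suc ∣ T ∣)
  lift-isTDS {T} T-tds with f x ∈? T
  ... | yes fx∈T = preimage T , preimage-isTDS T-tds fx∈T , ∣preimage∣-≤ T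
  ... | no fx∉T with T-tds (f x)
  ... | a , a∈T , fx~a with Equivalence.to (adj-H (f x) a) fx~a
  ... | _ , u , w , fu≡fx , fw≡a , u~w =
    preimage T ∪ ⁅ u ⁆ ,
    preimage∪endpoint-isTDS T-tds u∈xy (∈-preimage (subst (_∈ T) (sym fw≡a) a∈T)) u~w ,
    ≤-trans (∣p∪⁅x⁆∣≤1+∣p∣ (preimage T) u) (s≤s (≤-reflexive (∣preimage∣-∉ fx∉T)))
    where
      u∈xy : u ≡ x ⊎ u ≡ y
      u∈xy with f-injective-off u x fu≡fx
      ... | inj₁ u≡x        = inj₁ u≡x
      ... | inj₂ (u∈ , _)   = u∈

  γt-drops-at-most-one : ∀ {m} → (∀ S → IsTDS G S → m ≤ ∣ S ∣) → ∀ T → IsTDS H T → m ∸ 1 ≤ ∣ T ∣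
  γt-drops-at-most-one bound T T-tds =
    let (S , S-tds , ∣S∣≤) = lift-isTDS T-tds in ∸-monoˡ-≤ 1 (≤-trans (bound S S-tds) ∣S∣≤)

  contractEdge : ContractEdge G H
  contractEdge = x , y , f , x~y , f-merges , f-injective-off , f-surjective , adj-H

  ct≤1-of-small-TDS : ∀ {D} → IsMinTDS G D → ∀ S → IsTDS H S → ∣ S ∣ < ∣ D ∣ → CtGammaT≤ G 1
  ct≤1-of-small-TDS {D} D-min S S-tds ∣S∣<∣D∣ =
    1 , ≤-refl , H , step contractEdge done , GammaT≡-transfer {G} {H} 1 D-min S-min ∣S∣≡
    where
      lower : ∀ T → IsTDS H T → ∣ D ∣ ∸ 1 ≤ ∣ T ∣
      lower = γt-drops-at-most-one (proj₂ D-min)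
      ∣S∣≡ : ∣ S ∣ ≡ ∣ D ∣ ∸ 1
      ∣S∣≡ = ≤-antisym (<⇒≤∸1 ∣S∣<∣D∣) (lower S S-tds)
      S-min : IsMinTDS H S
      S-min = S-tds , λ T T-tds → subst (_≤ ∣ T ∣) (sym ∣S∣≡) (lower T T-tds)

ct≤1-of-path-in-D : ∀ {G D} → IsMinTDS G D → ∀ {u v t} → u ∈ D → v ∈ D → t ∈ D →
                    Adj G u v → t ≢ u → t ≢ v → Adj G t u ⊎ Adj G t v → CtGammaT≤ G 1
ct≤1-of-path-in-D {G} {D} D-min {u} {v} u∈D v∈D t∈D u~v t≢u t≢v t~uv =
  ct≤1-of-small-TDS D-min (image D) (image-isTDS (proj₁ D-min) (const u∈D) t∈D t≢u t≢v t~uv)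
    (≤-reflexive (sym (∣image∣-∈ v∈D)))
  where
    c : Contraction G u v
    c = contract G (Adj⇒≢ G u~v)
    open Contraction c
    open Contracted c u~v

module _ {G : Graph} {D : Subset (n G)} (D-min : IsMinTDS G D) {z w x y : Fin (n G)}
         (z∈D : z ∈ D) (w∉D : w ∉ D) (x∈D : x ∈ D) (y∈D : y ∈ D)
         (z~w : Adj G z w) (w~x : Adj G w x) (x~y : Adj G x y) (x≢z : x ≢ z) (y≢z : y ≢ z) where

  private
    c : Contraction G z w
    c = contract G (Adj⇒≢ G z~w)
    open Contraction c
    open Contracted c z~w

    x≢w : x ≢ w
    x≢w x≡w = w∉D (subst (_∈ D) x≡w x∈D)

    y≢w : y ≢ w
    y≢w y≡w = w∉D (subst (_∈ D) y≡w y∈D)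

    w∈D⇒z∈D : w ∈ D → z ∈ D
    w∈D⇒z∈D w∈D = contradiction w∈D w∉D

    image-isMinTDS : (∀ T → IsTDS H T → ∣ D ∣ ≤ ∣ T ∣) → IsMinTDS H (image D)
    image-isMinTDS bound = image-isTDS (proj₁ D-min) w∈D⇒z∈D x∈D x≢z x≢w (inj₂ (Adj-sym G w~x)) ,
                           λ T T-tds → subst (_≤ ∣ T ∣) (sym (∣image∣-∉ w∉D)) (bound T T-tds)

    fx~fz : Adj H (f x) (f z)
    fx~fz = subst (Adj H (f x)) (sym f-merges) (f-Adj (Adj-sym G w~x) (f-≢ x≢w x≢z x≢w))

    fy≢fx : f y ≢ f x
    fy≢fx = f-≢ (Adj⇒≢ G (Adj-sym G x~y)) y≢z y≢w

    fy~fx : Adj H (f y) (f x)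
    fy~fx = f-Adj (Adj-sym G x~y) fy≢fx

  ct≤2-of-path-via-outside : CtGammaT≤ G 2
  ct≤2-of-path-via-outside with anySubset? (λ S → IsTDS? H S ×-dec (∣ S ∣ <? ∣ D ∣))
  ... | yes (S , S-tds , ∣S∣<∣D∣) = CtGammaT≤-mono {G} (n≤1+n 1) (ct≤1-of-small-TDS D-min S S-tds ∣S∣<∣D∣)
  ... | no ∄small = CtGammaT≤-step {G} {H} contractEdge (GammaT≡-transfer {G} {H} 0 D-min D₁-min (∣image∣-∉ w∉D))
                      (ct≤1-of-path-in-D D₁-min (∈-image w∈D⇒z∈D x∈D) (∈-image w∈D⇒z∈D z∈D) (∈-image w∈D⇒z∈D y∈D)
                         fx~fz fy≢fx (f-≢ y≢z y≢z y≢w) (inj₁ fy~fx))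
    where
      D₁-min : IsMinTDS H (image D)
      D₁-min = image-isMinTDS λ T T-tds → ≮⇒≥ λ ∣T∣<∣D∣ → ∄small (T , T-tds , ∣T∣<∣D∣)

ct≤2-of-distance-2 : ∀ {G D} → IsMinTDS G D → ∀ {x y z} → x ∈ D → y ∈ D → z ∈ D →
                     x ≢ z → y ≢ z → Adj G x y → Dist≤ G 2 z x → CtGammaT≤ G 2
ct≤2-of-distance-2 D-min x∈D y∈D z∈D x≢z y≢z x~y (inj₁ z≡x) = contradiction (sym z≡x) x≢z
ct≤2-of-distance-2 {G} D-min x∈D y∈D z∈D x≢z y≢z x~y (inj₂ (_ , z~x , inj₁ refl)) =
  CtGammaT≤-mono {G} (n≤1+n 1) (ct≤1-of-path-in-D D-min x∈D y∈D z∈D x~y (x≢z ∘ sym) (y≢z ∘ sym) (inj₁ z~x))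
ct≤2-of-distance-2 {G} {D} D-min x∈D y∈D z∈D x≢z y≢z x~y (inj₂ (w , z~w , inj₂ (_ , w~x , refl))) with w ∈? D
... | yes w∈D = CtGammaT≤-mono {G} (n≤1+n 1)
                  (ct≤1-of-path-in-D D-min z∈D w∈D x∈D z~w x≢z (Adj⇒≢ G (Adj-sym G w~x)) (inj₂ (Adj-sym G w~x)))
... | no w∉D  = ct≤2-of-path-via-outside D-min z∈D w∉D x∈D y∈D z~w w~x x~y x≢z y≢z

lemma1 : (G : Graph) → Connected G → ∀ D → IsMinTDS G D → 3 ≤ ∣ D ∣ →
    ∀ x y z → x ∈ D → y ∈ D → z ∈ D → x ≢ y → x ≢ z → y ≢ z →
    Adj G x y → (Dist≤ G 2 z x ⊎ Dist≤ G 2 z y) →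
    CtGammaT≤ G 2
lemma1 G _ D D-min _ x y z x∈D y∈D z∈D _ x≢z y≢z x~y (inj₁ d) =
  ct≤2-of-distance-2 D-min x∈D y∈D z∈D x≢z y≢z x~y d
lemma1 G _ D D-min _ x y z x∈D y∈D z∈D _ x≢z y≢z x~y (inj₂ d) =
  ct≤2-of-distance-2 D-min y∈D x∈D z∈D y≢z x≢z (Adj-sym G x~y) d
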